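{- Let $(D,\to,g)$ be a gauged system that is monotone and convergent. Then for any $d,e\in D$, $d\stackrel{*}{\leftrightarrow}e$ implies $g(d{\downarrow})\le g(e)$, where $d{\downarrow}$ denotes the unique normal form of $d$. That is, for any element $d$, its normal form $d{\downarrow}$ has minimum gauge among all elements $e$ with $d\stackrel{*}{\leftrightarrow}e$.
   Context: A system is a pair $(D,\to)$ of a set $D$ and a binary relation $\to$ on $D$; $\stackrel{*}{\to}$ is the reflexive-transitive closure of $\to$, and $\stackrel{*}{\leftrightarrow}$ is the reflexive-transitive closure of the union of $\to$ and its inverse. An element $e$ is in normal form if there is no $e'$ with $e\to e'$; $e$ is a normal form of $d$ if $d\stackrel{*}{\to}e$ and $e$ is in normal form. The system is confluent if $d\stackrel{*}{\to}e$ and $d\stackrel{*}{\to}e'$ imply some $f$ with $e\stackrel{*}{\to}f$ and $e'\stackrel{*}{\to}f$; terminating if there is no infinite chain $d_0\to d_1\to\cdots$; convergent if both (in a convergent system every element has a unique normal form). A gauged system is a triple $(D,\to,g)$ with $(D,\to)$ a system and $g:D\to\mathbb{R}$; it is monotone if $d\to e$ implies $g(d)\ge g(e)$, and convergent if $(D,\to)$ is. -}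

module Defs where

import Level
open import Data.Nat using (ℕ; suc)
open import Data.Product using (Σ; _×_)
open import Relation.Nullary using (¬_)
open import Relation.Binary.Bundles using (TotalOrder)
open import Relation.Binary.Construct.Closure.ReflexiveTransitive using (Star)
open import Relation.Binary.Construct.Closure.Equivalence using (EqClosure)

record System : Set₁ where
  field
    D   : Set
    _⟶_ : D → D → Set

  _⟶*_ : D → D → Set
  _⟶*_ = Star _⟶_

  _↔*_ : D → D → Set
  _↔*_ = EqClosure _⟶_

  IsNormal : D → Set
  IsNormal e = ∀ e' → ¬ (e ⟶ e')

  NormalFormOf : D → D → Set
  NormalFormOf e d = (d ⟶* e) × IsNormal e

  Confluent : Set
  Confluent = ∀ {d e e'} → d ⟶* e → d ⟶* e' → Σ D (λ f → (e ⟶* f) × (e' ⟶* f))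

  Terminating : Set
  Terminating = ¬ (Σ (ℕ → D) (λ f → ∀ n → f n ⟶ f (suc n)))

  Convergent : Set
  Convergent = Confluent × Terminating

-- A gauged system with gauge values in a totally ordered set O
-- (the paper uses O = ℝ with its usual order, unavailable in agda-stdlib).
record GaugedSystem {c ℓ₁ ℓ₂} (O : TotalOrder c ℓ₁ ℓ₂) : Set (Level.suc Level.zero Level.⊔ c) where
  field
    system : System
  open System system public
  open TotalOrder O using (Carrier; _≤_)
  field
    g : D → Carrier

  Monotone : Set ℓ₂
  Monotone = ∀ {d e} → d ⟶ e → g e ≤ g d

{-# OPTIONS --safe #-}
module Submission where

-- By confluence, a normal form of d is also a normal form of every e with
-- d ↔* e, so e ⟶* d↓ and monotonicity of the gauge along that reduction gives
-- g d↓ ≤ g e.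

open import Defs
open import Relation.Binary.Bundles using (TotalOrder)
open import Data.Product using (_,_; proj₁)
open import Data.Empty using (⊥-elim)
open import Relation.Binary.PropositionalEquality using (_≡_; refl; subst)
open import Relation.Binary.Construct.Closure.ReflexiveTransitive using (ε; _◅_; fold)
open import Relation.Binary.Construct.Closure.Symmetric using (fwd; bwd)

module _ (S : System) where
  open System S

  IsNormal-⟶*⇒≡ : ∀ {n h} → IsNormal n → n ⟶* h → h ≡ n
  IsNormal-⟶*⇒≡ _        ε         = refl
  IsNormal-⟶*⇒≡ n-normal (n⟶h ◅ _) = ⊥-elim (n-normal _ n⟶h)

  Confluent⇒NormalFormOf-resp-⟶ : Confluent →
    ∀ {n x y} → x ⟶ y → NormalFormOf n x → NormalFormOf n y
  Confluent⇒NormalFormOf-resp-⟶ conf {y = y} x⟶y (x⟶*n , n-normal)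
    with conf (x⟶y ◅ ε) x⟶*n
  ... | _ , y⟶*h , n⟶*h = subst (y ⟶*_) (IsNormal-⟶*⇒≡ n-normal n⟶*h) y⟶*h , n-normal

  Confluent⇒NormalFormOf-resp-↔* : Confluent →
    ∀ {n x y} → x ↔* y → NormalFormOf n x → NormalFormOf n y
  Confluent⇒NormalFormOf-resp-↔* conf ε nf = nf
  Confluent⇒NormalFormOf-resp-↔* conf (fwd x⟶y ◅ y↔*z) nf =
    Confluent⇒NormalFormOf-resp-↔* conf y↔*z (Confluent⇒NormalFormOf-resp-⟶ conf x⟶y nf)
  Confluent⇒NormalFormOf-resp-↔* conf (bwd y⟶x ◅ y↔*z) (x⟶*n , n-normal) =
    Confluent⇒NormalFormOf-resp-↔* conf y↔*z (y⟶x ◅ x⟶*n , n-normal)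

module _ {c ℓ₁ ℓ₂} {O : TotalOrder c ℓ₁ ℓ₂} (G : GaugedSystem O) where
  open GaugedSystem G
  open TotalOrder O using (_≤_) renaming (refl to ≤-refl; trans to ≤-trans)

  Monotone⇒antitone-⟶* : Monotone → ∀ {x y} → x ⟶* y → g y ≤ g x
  Monotone⇒antitone-⟶* mono =
    fold (λ x y → g y ≤ g x) (λ x⟶y gz≤gy → ≤-trans gz≤gy (mono x⟶y)) ≤-refl

proposition2p3 : ∀ {c ℓ₁ ℓ₂} (O : TotalOrder c ℓ₁ ℓ₂) (G : GaugedSystem O) →
    GaugedSystem.Monotone G → GaugedSystem.Convergent G →
    ∀ (d e d↓ : GaugedSystem.D G) →
    GaugedSystem._↔*_ G d e → GaugedSystem.NormalFormOf G d↓ d →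
    TotalOrder._≤_ O (GaugedSystem.g G d↓) (GaugedSystem.g G e)
proposition2p3 O G mono (conf , _) d e d↓ d↔*e d↓-nf-of-d =
  Monotone⇒antitone-⟶* G mono e⟶*d↓
  where
  e⟶*d↓ : GaugedSystem._⟶*_ G e d↓
  e⟶*d↓ = proj₁ (Confluent⇒NormalFormOf-resp-↔* (GaugedSystem.system G) conf d↔*e d↓-nf-of-d)
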